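{- $\{\neg(\neg p_1\land p_2),\ \neg(\neg(p_3\land p_4)\land p_2)\}\vdash^{\leq}_{\mathbb{SDM}}\neg(\neg(p_1\land p_4)\land p_2)$, i.e., the rule $\frac{\neg(\neg p_1\land p_2)\quad\neg(\neg(p_3\land p_4)\land p_2)}{\neg(\neg(p_1\land p_4)\land p_2)}$ is sound with respect to $\vdash^{\leq}_{\mathbb{SDM}}$.
   Context: Language: binary $\land,\lor$, unary $\neg$, constants $\bot,\top$; $p_1,\dots,p_4$ are propositional variables. A semi-De Morgan algebra is an algebra $\langle A;\land,\lor,\neg,\bot,\top\rangle$ whose reduct is a bounded distributive lattice and which satisfies $\neg\bot\approx\top$, $\neg(x\lor y)\approx\neg x\land\neg y$, $\neg\top\approx\bot$, $\neg\neg(x\land y)\approx\neg\neg x\land\neg\neg y$, $\neg x\approx\neg\neg\neg x$; $\mathbb{SDM}$ is their variety. $\Gamma\vdash^{\leq}_{\mathbb{SDM}}\varphi$ iff for every $\mathbf{A}\in\mathbb{SDM}$, every non-empty lattice filter $F$ of $\mathbf{A}$ and every homomorphism $h$ from the formula algebra to $\mathbf{A}$, $h[\Gamma]\subseteq F$ implies $h(\varphi)\in F$. -}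

module Defs where

open import Level using (Level; _⊔_; suc)
open import Data.Nat using (ℕ)
open import Data.Product using (∃)
open import Relation.Binary.PropositionalEquality using (_≡_)
open import Algebra.Core using (Op₁; Op₂)
open import Algebra.Definitions using (Identity)
open import Algebra.Lattice.Structures using (IsDistributiveLattice)

record IsSemiDeMorgan {a} {A : Set a} (_∧_ _∨_ : Op₂ A) (¬_ : Op₁ A) (⊥ ⊤ : A) : Set a where
  field
    isDistributiveLattice : IsDistributiveLattice _≡_ _∨_ _∧_
    ⊥-identity-∨ : Identity _≡_ ⊥ _∨_
    ⊤-identity-∧ : Identity _≡_ ⊤ _∧_
    ¬⊥≈⊤ : ¬ ⊥ ≡ ⊤
    ¬-∨ : ∀ x y → ¬ (x ∨ y) ≡ ((¬ x) ∧ (¬ y))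
    ¬⊤≈⊥ : ¬ ⊤ ≡ ⊥
    ¬¬-∧ : ∀ x y → ¬ (¬ (x ∧ y)) ≡ ((¬ (¬ x)) ∧ (¬ (¬ y)))
    ¬≈¬¬¬ : ∀ x → ¬ x ≡ ¬ (¬ (¬ x))

record SemiDeMorgan (a : Level) : Set (suc a) where
  infixr 7 _∧_
  infixr 6 _∨_
  field
    Carrier : Set a
    _∧_ _∨_ : Op₂ Carrier
    ¬_ : Op₁ Carrier
    ⊥ ⊤ : Carrier
    isSemiDeMorgan : IsSemiDeMorgan _∧_ _∨_ ¬_ ⊥ ⊤

  _≤_ : Carrier → Carrier → Set a
  x ≤ y = (x ∧ y) ≡ x

record IsFilter {a ℓ} (A : SemiDeMorgan a) (F : SemiDeMorgan.Carrier A → Set ℓ) : Set (a ⊔ ℓ) where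
  open SemiDeMorgan A
  field
    nonEmpty : ∃ F
    upward : ∀ {x y} → x ≤ y → F x → F y
    ∧-closed : ∀ {x y} → F x → F y → F (x ∧ y)

data Fm : Set where
  var : ℕ → Fm
  _∧ᶠ_ _∨ᶠ_ : Fm → Fm → Fm
  ¬ᶠ_ : Fm → Fm
  ⊥ᶠ ⊤ᶠ : Fm

infixr 7 _∧ᶠ_
infixr 6 _∨ᶠ_
infix 8 ¬ᶠ_

record IsHom {a} (A : SemiDeMorgan a) (h : Fm → SemiDeMorgan.Carrier A) : Set a where
  open SemiDeMorgan A
  field
    hom-∧ : ∀ φ ψ → h (φ ∧ᶠ ψ) ≡ (h φ ∧ h ψ)
    hom-∨ : ∀ φ ψ → h (φ ∨ᶠ ψ) ≡ (h φ ∨ h ψ)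
    hom-¬ : ∀ φ → h (¬ᶠ φ) ≡ ¬ (h φ)
    hom-⊥ : h ⊥ᶠ ≡ ⊥
    hom-⊤ : h ⊤ᶠ ≡ ⊤

p₁ p₂ p₃ p₄ : Fm
p₁ = var 1
p₂ = var 2
p₃ = var 3
p₄ = var 4

{-# OPTIONS --safe #-}

-- Since ¬ x = ¬ ¬ ¬ x, an inequality ¬ ¬ u ≤ ¬ ¬ v yields ¬ v ≤ ¬ u, and ¬ ¬ commutes with ∧.
-- The meet of the premises is ¬ ((¬ p₁ ∨ ¬ (p₃ ∧ p₄)) ∧ p₂), whose double negation is
-- ¬ (p₁ ∧ p₃ ∧ p₄) ∧ ¬ ¬ p₂; it lies above ¬ (p₁ ∧ p₄) ∧ ¬ ¬ p₂, the double negation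
-- of ¬ (p₁ ∧ p₄) ∧ p₂. So the meet of the premises lies below the conclusion, and
-- filters are closed under meets and upwards.

module Submission where

open import Defs
open import Level using (Level)
open import Relation.Binary.PropositionalEquality using (_≡_; sym; trans; cong; subst)
open import Algebra.Lattice.Bundles using (Lattice)
open import Algebra.Lattice.Structures using (IsDistributiveLattice)
import Algebra.Lattice.Properties.Lattice as LatticeProperties
import Relation.Binary.Lattice as OrderTheoretic
import Relation.Binary.Lattice.Properties.JoinSemilattice as JoinSemilatticeProperties
import Relation.Binary.Lattice.Properties.MeetSemilattice as MeetSemilatticeProperties
import Relation.Binary.Reasoning.PartialOrder as PartialOrderReasoning

module SemiDeMorganProperties {a} (A : SemiDeMorgan a) where

  open SemiDeMorgan A hiding (_≤_)
  open IsSemiDeMorgan isSemiDeMorgan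
  open IsDistributiveLattice isDistributiveLattice using (isLattice; ∧-distribʳ-∨)

  lattice : Lattice a a
  lattice = record { isLattice = isLattice }

  -- The library's natural order x ≤ y is x ≡ x ∧ y, the symmetric form of the order in Defs.
  orderLattice : OrderTheoretic.Lattice a a a
  orderLattice = LatticeProperties.∨-∧-orderTheoreticLattice lattice

  open OrderTheoretic.Lattice orderLattice public
    using (_≤_; poset; joinSemilattice; meetSemilattice; x∧y≤x; x∧y≤y)
    renaming (refl to ≤-refl)
  open JoinSemilatticeProperties joinSemilattice using (x≤y⇒x∨y≈y)
  open MeetSemilatticeProperties meetSemilattice public using (∧-monotonic)
  open PartialOrderReasoning poset public

  ¬-antitone : ∀ {x y} → x ≤ y → ¬ y ≤ ¬ x
  ¬-antitone {x} {y} x≤y = begin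
    ¬ y         ≡⟨ cong ¬_ (sym (x≤y⇒x∨y≈y x≤y)) ⟩
    ¬ (x ∨ y)   ≡⟨ ¬-∨ x y ⟩
    ¬ x ∧ ¬ y   ≤⟨ x∧y≤x (¬ x) (¬ y) ⟩
    ¬ x         ∎

  ¬¬x≤¬¬y⇒¬y≤¬x : ∀ {x y} → ¬ ¬ x ≤ ¬ ¬ y → ¬ y ≤ ¬ x
  ¬¬x≤¬¬y⇒¬y≤¬x {x} {y} ¬¬x≤¬¬y = begin
    ¬ y         ≡⟨ ¬≈¬¬¬ y ⟩
    ¬ ¬ ¬ y     ≤⟨ ¬-antitone ¬¬x≤¬¬y ⟩
    ¬ ¬ ¬ x     ≡⟨ sym (¬≈¬¬¬ x) ⟩
    ¬ x         ∎

  ¬¬-¬∧ : ∀ x y → ¬ ¬ (¬ x ∧ y) ≡ ¬ x ∧ ¬ ¬ y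
  ¬¬-¬∧ x y = trans (¬¬-∧ (¬ x) y) (cong (_∧ ¬ ¬ y) (sym (¬≈¬¬¬ x)))

  ¬¬-¬∨¬ : ∀ x y → ¬ ¬ (¬ x ∨ ¬ y) ≡ ¬ (x ∧ y)
  ¬¬-¬∨¬ x y = begin-equality
    ¬ ¬ (¬ x ∨ ¬ y)      ≡⟨ cong ¬_ (¬-∨ (¬ x) (¬ y)) ⟩
    ¬ (¬ ¬ x ∧ ¬ ¬ y)    ≡⟨ cong ¬_ (sym (¬¬-∧ x y)) ⟩
    ¬ ¬ ¬ (x ∧ y)        ≡⟨ sym (¬≈¬¬¬ (x ∧ y)) ⟩
    ¬ (x ∧ y)            ∎

  ¬-¬∧-meet : ∀ x y z → ¬ (¬ x ∧ z) ∧ ¬ (¬ y ∧ z) ≡ ¬ ((¬ x ∨ ¬ y) ∧ z)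
  ¬-¬∧-meet x y z = begin-equality
    ¬ (¬ x ∧ z) ∧ ¬ (¬ y ∧ z)   ≡⟨ sym (¬-∨ (¬ x ∧ z) (¬ y ∧ z)) ⟩
    ¬ (¬ x ∧ z ∨ ¬ y ∧ z)       ≡⟨ cong ¬_ (sym (∧-distribʳ-∨ z (¬ x) (¬ y))) ⟩
    ¬ ((¬ x ∨ ¬ y) ∧ z)         ∎

  ¬-¬∧-meet-≤ : ∀ {x y w} z → x ∧ y ≤ w → ¬ (¬ x ∧ z) ∧ ¬ (¬ y ∧ z) ≤ ¬ (¬ w ∧ z)
  ¬-¬∧-meet-≤ {x} {y} {w} z x∧y≤w = begin
    ¬ (¬ x ∧ z) ∧ ¬ (¬ y ∧ z)   ≡⟨ ¬-¬∧-meet x y z ⟩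
    ¬ ((¬ x ∨ ¬ y) ∧ z)         ≤⟨ ¬¬x≤¬¬y⇒¬y≤¬x ¬¬-conclusion≤¬¬-meet ⟩
    ¬ (¬ w ∧ z)                 ∎
    where
    ¬¬-conclusion≤¬¬-meet : ¬ ¬ (¬ w ∧ z) ≤ ¬ ¬ ((¬ x ∨ ¬ y) ∧ z)
    ¬¬-conclusion≤¬¬-meet = begin
      ¬ ¬ (¬ w ∧ z)                ≡⟨ ¬¬-¬∧ w z ⟩
      ¬ w ∧ ¬ ¬ z                  ≤⟨ ∧-monotonic (¬-antitone x∧y≤w) (≤-refl {¬ ¬ z}) ⟩
      ¬ (x ∧ y) ∧ ¬ ¬ z            ≡⟨ cong (_∧ ¬ ¬ z) (sym (¬¬-¬∨¬ x y)) ⟩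
      ¬ ¬ (¬ x ∨ ¬ y) ∧ ¬ ¬ z      ≡⟨ sym (¬¬-∧ (¬ x ∨ ¬ y) z) ⟩
      ¬ ¬ ((¬ x ∨ ¬ y) ∧ z)        ∎

  meet-≤-closed : ∀ {ℓ} {F : Carrier → Set ℓ} → IsFilter A F →
                  ∀ {x y z} → F x → F y → x ∧ y ≤ z → F z
  meet-≤-closed isFilter Fx Fy x∧y≤z = upward (sym x∧y≤z) (∧-closed Fx Fy)
    where open IsFilter isFilter

  module _ {h : Fm → Carrier} (isHom : IsHom A h) where

    open IsHom isHom

    hom-¬¬∧ : ∀ φ ψ → h (¬ᶠ (¬ᶠ φ ∧ᶠ ψ)) ≡ ¬ (¬ h φ ∧ h ψ)
    hom-¬¬∧ φ ψ = begin-equality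
      h (¬ᶠ (¬ᶠ φ ∧ᶠ ψ))   ≡⟨ hom-¬ (¬ᶠ φ ∧ᶠ ψ) ⟩
      ¬ h (¬ᶠ φ ∧ᶠ ψ)      ≡⟨ cong ¬_ (hom-∧ (¬ᶠ φ) ψ) ⟩
      ¬ (h (¬ᶠ φ) ∧ h ψ)   ≡⟨ cong (λ t → ¬ (t ∧ h ψ)) (hom-¬ φ) ⟩
      ¬ (¬ h φ ∧ h ψ)      ∎

    hom-φ∧[ψ∧χ]≤φ∧χ : ∀ φ ψ χ → h φ ∧ h (ψ ∧ᶠ χ) ≤ h (φ ∧ᶠ χ)
    hom-φ∧[ψ∧χ]≤φ∧χ φ ψ χ = begin
      h φ ∧ h (ψ ∧ᶠ χ)    ≡⟨ cong (h φ ∧_) (hom-∧ ψ χ) ⟩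
      h φ ∧ (h ψ ∧ h χ)   ≤⟨ ∧-monotonic (≤-refl {h φ}) (x∧y≤y (h ψ) (h χ)) ⟩
      h φ ∧ h χ           ≡⟨ sym (hom-∧ φ χ) ⟩
      h (φ ∧ᶠ χ)          ∎

lemma4p4 : ∀ {a ℓ : Level} (A : SemiDeMorgan a) (F : SemiDeMorgan.Carrier A → Set ℓ) →
    IsFilter A F → (h : Fm → SemiDeMorgan.Carrier A) → IsHom A h →
    F (h (¬ᶠ (¬ᶠ p₁ ∧ᶠ p₂))) →
    F (h (¬ᶠ (¬ᶠ (p₃ ∧ᶠ p₄) ∧ᶠ p₂))) →
    F (h (¬ᶠ (¬ᶠ (p₁ ∧ᶠ p₄) ∧ᶠ p₂)))
lemma4p4 A F isFilter h isHom premise₁ premise₂ =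
  subst F (sym (hom-¬¬∧ isHom (p₁ ∧ᶠ p₄) p₂))
    (meet-≤-closed isFilter
      (subst F (hom-¬¬∧ isHom p₁ p₂) premise₁)
      (subst F (hom-¬¬∧ isHom (p₃ ∧ᶠ p₄) p₂) premise₂)
      (¬-¬∧-meet-≤ (h p₂) (hom-φ∧[ψ∧χ]≤φ∧χ isHom p₁ p₃ p₄)))
  where open SemiDeMorganProperties A
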